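{- Let $\pi\in S_n$ be a permutation of $\{1,\dots,n\}$ and let $X=\{1,2,\dots,n\}$. Define binary relations $S$ and $R$ on $X$ by: $iSj$ if and only if $i<j$ and $\pi(i)>\pi(j)$; $iRj$ if and only if $i<j$ and $\pi(i)<\pi(j)$. Then $\pi$ is $312$-avoiding if and only if $(S,R)$ is a Catalan pair on $X$.
   Context: A permutation $\pi\in S_n$ contains the pattern $\nu\in S_m$ if there are indices $i_1<\dots<i_m$ such that $(\pi(i_1),\dots,\pi(i_m))$ is in the same relative order as $(\nu(1),\dots,\nu(m))$; otherwise $\pi$ is $\nu$-avoiding. For a set $X$, let $\mathcal{D}=\{(x,x): x\in X\}$, and for a relation $\theta$ let $\overline{\theta}=\theta\cup\theta^{ -1}$. An ordered pair $(S,R)$ of binary relations on a finite set $X$ is a Catalan pair on $X$ if: (i) $S$ and $R$ are irreflexive and transitive; (ii) $\overline{R}\cup\overline{S}=X^2\setminus\mathcal{D}$; (iii) $\overline{R}\cap\overline{S}=\emptyset$; (iv) whenever $xSy$ and $yRz$ then $xRz$. -}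

module Defs where

open import Level using (0ℓ)
open import Data.Nat using (ℕ)
open import Data.Fin using (Fin; zero; suc; _<_)
open import Data.Product using (Σ; ∃; _×_; _,_)
open import Data.Sum using (_⊎_)
open import Data.Empty using (⊥)
open import Relation.Nullary using (¬_)
open import Relation.Binary.Core using (Rel)
open import Relation.Binary.PropositionalEquality using (_≡_)
open import Function.Bundles using (_↔_; Inverse)

-- S_n : permutations of the n-element set Fin n (= {1,…,n} shifted to {0,…,n-1})
Perm : ℕ → Set
Perm n = Fin n ↔ Fin n

app : ∀ {n} → Perm n → Fin n → Fin n
app π = Inverse.to π

Contains : ∀ {n m} → Perm n → Perm m → Set
Contains {n} {m} π ν =
  Σ (Fin m → Fin n) λ ι →
    (∀ a b → a < b → ι a < ι b) ×
    (∀ a b → (app π (ι a) < app π (ι b) → app ν a < app ν b)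
           × (app ν a < app ν b → app π (ι a) < app π (ι b)))

Avoids : ∀ {n m} → Perm n → Perm m → Set
Avoids π ν = ¬ Contains π ν

-- the pattern 312 ∈ S_3 (0-based: 3 1 2 ↦ 2 0 1)
p312-to : Fin 3 → Fin 3
p312-to zero = suc (suc zero)
p312-to (suc zero) = zero
p312-to (suc (suc zero)) = suc zero

p312-from : Fin 3 → Fin 3
p312-from zero = suc zero
p312-from (suc zero) = suc (suc zero)
p312-from (suc (suc zero)) = zero

p312-inv₁ : ∀ x → p312-to (p312-from x) ≡ x
p312-inv₁ zero = _≡_.refl
p312-inv₁ (suc zero) = _≡_.refl
p312-inv₁ (suc (suc zero)) = _≡_.refl

p312-inv₂ : ∀ x → p312-from (p312-to x) ≡ x
p312-inv₂ zero = _≡_.refl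
p312-inv₂ (suc zero) = _≡_.refl
p312-inv₂ (suc (suc zero)) = _≡_.refl

open import Function.Bundles using (mk↔ₛ′)

p312 : Perm 3
p312 = mk↔ₛ′ p312-to p312-from p312-inv₁ p312-inv₂

module _ {X : Set} where
  Irreflexive : Rel X 0ℓ → Set
  Irreflexive θ = ∀ x → ¬ θ x x

  Transitive : Rel X 0ℓ → Set
  Transitive θ = ∀ x y z → θ x y → θ y z → θ x z

  sym-closure : Rel X 0ℓ → Rel X 0ℓ
  sym-closure θ x y = θ x y ⊎ θ y x

  record CatalanPair (S R : Rel X 0ℓ) : Set where
    field
      S-irrefl : Irreflexive S
      S-trans  : Transitive S
      R-irrefl : Irreflexive R
      R-trans  : Transitive R
      -- R̄ ∪ S̄ = X² ∖ D  (both inclusions)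
      cover    : ∀ x y → (sym-closure R x y ⊎ sym-closure S x y) → ¬ x ≡ y
      cover'   : ∀ x y → ¬ x ≡ y → (sym-closure R x y ⊎ sym-closure S x y)
      disjoint : ∀ x y → sym-closure R x y → sym-closure S x y → ⊥
      SR⇒R     : ∀ x y z → S x y → R y z → R x z

S-of : ∀ {n} → Perm n → Rel (Fin n) 0ℓ
S-of π i j = (i < j) × (app π j < app π i)

R-of : ∀ {n} → Perm n → Rel (Fin n) 0ℓ
R-of π i j = (i < j) × (app π i < app π j)

-- Work with an arbitrary injective sequence f : Fin n → Fin m;
-- S = Desc f ("i < j, f descends") and R = Asc f ("i < j, f ascends").
--   * Axioms (i)–(iii) of a Catalan pair hold for every injective f:
--     both relations are strict orders contained in <, and since f is
--     injective any two distinct positions are related by exactly one of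
--     S, S⁻¹, R, R⁻¹ (trichotomy of < on positions and on values).
--   * For injective f, axiom (iv), "x S y and y R z imply x R z", fails
--     exactly on an occurrence of 312: positions x < y < z with
--     f y < f z < f x.  Indeed x S y, y R z force x < z, so x R z can
--     only fail by f z < f x.
--   * An occurrence of 312 in app π is the same thing as a witness of
--     Contains π p312 (read off / build the order embedding of Fin 3).
module Submission where

open import Defs
open import Data.Nat using (ℕ; s≤s; z≤n)
open import Data.Fin using (Fin; zero; suc; _<_)
open import Data.Fin.Properties using (<-irrefl; <-asym; <-trans; <-cmp)
open import Data.Product using (_×_; _,_; proj₁; proj₂)
open import Data.Sum using (_⊎_; inj₁; inj₂)
open import Data.Empty using (⊥; ⊥-elim)
open import Relation.Nullary using (¬_)
open import Relation.Binary.Core using (Rel)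
open import Relation.Binary.Definitions using (tri<; tri≈; tri>)
open import Relation.Binary.PropositionalEquality using (_≡_; refl)
open import Function.Definitions using (Injective)
open import Function.Bundles using (_⇔_; mk⇔; Injection)
open import Function.Properties.Inverse using (↔⇒↣)
open import Level using (0ℓ)

<-irreflexive : ∀ {n} {a : Fin n} → ¬ (a < a)
<-irreflexive = <-irrefl refl

module Sequence {n m : ℕ} (f : Fin n → Fin m) where

  -- i < j is an inversion / a non-inversion of f.  For f = app π these are
  -- definitionally S-of π and R-of π.
  Desc : Rel (Fin n) 0ℓ
  Desc i j = (i < j) × (f j < f i)

  Asc : Rel (Fin n) 0ℓ
  Asc i j = (i < j) × (f i < f j)

  record Occurrence312 : Set where
    field
      {x y z} : Fin n
      x<y     : x < y
      y<z     : y < z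
      fy<fz   : f y < f z
      fz<fx   : f z < f x

  SR⇒R-if-no312 : Injective _≡_ _≡_ f → ¬ Occurrence312 →
                  ∀ x y z → Desc x y → Asc y z → Asc x z
  SR⇒R-if-no312 f-inj no312 x y z (x<y , _) (y<z , fy<fz) with <-cmp (f x) (f z)
  ... | tri< fx<fz _ _ = <-trans x<y y<z , fx<fz
  ... | tri≈ _ fx≡fz _ = ⊥-elim (<-irrefl (f-inj fx≡fz) (<-trans x<y y<z))
  ... | tri> _ _ fz<fx = ⊥-elim (no312 (record
    { x<y = x<y ; y<z = y<z ; fy<fz = fy<fz ; fz<fx = fz<fx }))

  no312-if-SR⇒R : (∀ x y z → Desc x y → Asc y z → Asc x z) → ¬ Occurrence312
  no312-if-SR⇒R SR⇒R o =
    <-asym fz<fx (proj₂ (SR⇒R x y z (x<y , <-trans fy<fz fz<fx) (y<z , fy<fz)))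
    where open Occurrence312 o

  catalanPair-if-no312 : Injective _≡_ _≡_ f → ¬ Occurrence312 → CatalanPair Desc Asc
  catalanPair-if-no312 f-inj no312 = record
    { S-irrefl = λ _ d → <-irreflexive (proj₁ d)
    ; S-trans  = λ _ _ _ (i<j , fj<fi) (j<k , fk<fj) → <-trans i<j j<k , <-trans fk<fj fj<fi
    ; R-irrefl = λ _ a → <-irreflexive (proj₁ a)
    ; R-trans  = λ _ _ _ (i<j , fi<fj) (j<k , fj<fk) → <-trans i<j j<k , <-trans fi<fj fj<fk
    ; cover    = related⇒distinct
    ; cover'   = distinct⇒related
    ; disjoint = exclusive
    ; SR⇒R     = SR⇒R-if-no312 f-inj no312
    }
    where
    Related : Rel (Fin n) 0ℓ
    Related i j = sym-closure Asc i j ⊎ sym-closure Desc i j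

    related⇒distinct : ∀ i j → Related i j → ¬ i ≡ j
    related⇒distinct i .i (inj₁ (inj₁ (i<i , _))) refl = <-irreflexive i<i
    related⇒distinct i .i (inj₁ (inj₂ (i<i , _))) refl = <-irreflexive i<i
    related⇒distinct i .i (inj₂ (inj₁ (i<i , _))) refl = <-irreflexive i<i
    related⇒distinct i .i (inj₂ (inj₂ (i<i , _))) refl = <-irreflexive i<i

    distinct⇒related : ∀ i j → ¬ i ≡ j → Related i j
    distinct⇒related i j i≢j with <-cmp i j | <-cmp (f i) (f j)
    ... | tri≈ _ i≡j _ | _              = ⊥-elim (i≢j i≡j)
    ... | _            | tri≈ _ fi≡fj _ = ⊥-elim (i≢j (f-inj fi≡fj))
    ... | tri< i<j _ _ | tri< fi<fj _ _ = inj₁ (inj₁ (i<j , fi<fj))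
    ... | tri< i<j _ _ | tri> _ _ fj<fi = inj₂ (inj₁ (i<j , fj<fi))
    ... | tri> _ _ j<i | tri< fi<fj _ _ = inj₂ (inj₂ (j<i , fi<fj))
    ... | tri> _ _ j<i | tri> _ _ fj<fi = inj₁ (inj₂ (j<i , fj<fi))

    exclusive : ∀ i j → sym-closure Asc i j → sym-closure Desc i j → ⊥
    exclusive i j (inj₁ (_ , fi<fj)) (inj₁ (_ , fj<fi)) = <-asym fi<fj fj<fi
    exclusive i j (inj₁ (i<j , _))   (inj₂ (j<i , _))   = <-asym i<j j<i
    exclusive i j (inj₂ (j<i , _))   (inj₁ (i<j , _))   = <-asym j<i i<j
    exclusive i j (inj₂ (_ , fj<fi)) (inj₂ (_ , fi<fj)) = <-asym fj<fi fi<fj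

open Sequence

module _ {n : ℕ} (π : Perm n) where

  contains⇒occurrence : Contains π p312 → Occurrence312 (app π)
  contains⇒occurrence (ι , increasing , orderIso) = record
    { x<y   = increasing zero (suc zero) (s≤s z≤n)
    ; y<z   = increasing (suc zero) (suc (suc zero)) (s≤s (s≤s z≤n))
    ; fy<fz = proj₂ (orderIso (suc zero) (suc (suc zero))) (s≤s z≤n)
    ; fz<fx = proj₂ (orderIso (suc (suc zero)) zero) (s≤s (s≤s z≤n))
    }

  occurrence⇒contains : Occurrence312 (app π) → Contains π p312
  occurrence⇒contains o = ι , increasing , orderIso
    where
    open Occurrence312 o
    p = app π

    ι : Fin 3 → Fin n
    ι zero             = x
    ι (suc zero)       = y
    ι (suc (suc zero)) = z

    increasing : ∀ a b → a < b → ι a < ι b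
    increasing zero (suc zero)             _ = x<y
    increasing zero (suc (suc zero))       _ = <-trans x<y y<z
    increasing (suc zero) (suc (suc zero)) _ = y<z
    increasing zero zero ()
    increasing (suc zero) zero ()
    increasing (suc zero) (suc zero) (s≤s ())
    increasing (suc (suc zero)) zero ()
    increasing (suc (suc zero)) (suc zero) (s≤s ())
    increasing (suc (suc zero)) (suc (suc zero)) (s≤s (s≤s ()))

    fy<fx : p y < p x
    fy<fx = <-trans fy<fz fz<fx

    orderIso : ∀ a b → (p (ι a) < p (ι b) → app p312 a < app p312 b)
                     × (app p312 a < app p312 b → p (ι a) < p (ι b))
    orderIso zero zero                         = (λ h → ⊥-elim (<-irreflexive h)) , λ h → ⊥-elim (<-irreflexive {3} h)
    orderIso zero (suc zero)                   = (λ h → ⊥-elim (<-asym h fy<fx)) , λ ()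
    orderIso zero (suc (suc zero))             = (λ h → ⊥-elim (<-asym h fz<fx)) , λ { (s≤s ()) }
    orderIso (suc zero) zero                   = (λ _ → s≤s z≤n) , λ _ → fy<fx
    orderIso (suc zero) (suc zero)             = (λ h → ⊥-elim (<-irreflexive h)) , λ h → ⊥-elim (<-irreflexive {3} h)
    orderIso (suc zero) (suc (suc zero))       = (λ _ → s≤s z≤n) , λ _ → fy<fz
    orderIso (suc (suc zero)) zero             = (λ _ → s≤s (s≤s z≤n)) , λ _ → fz<fx
    orderIso (suc (suc zero)) (suc zero)       = (λ h → ⊥-elim (<-asym h fy<fz)) , λ ()
    orderIso (suc (suc zero)) (suc (suc zero)) = (λ h → ⊥-elim (<-irreflexive h)) , λ h → ⊥-elim (<-irreflexive {3} h)

proposition2 : (n : ℕ) (π : Perm n) → Avoids π p312 ⇔ CatalanPair (S-of π) (R-of π)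
proposition2 n π = mk⇔ avoids⇒catalan catalan⇒avoids
  where
  avoids⇒catalan : Avoids π p312 → CatalanPair (S-of π) (R-of π)
  avoids⇒catalan avoids =
    catalanPair-if-no312 (app π) (Injection.injective (↔⇒↣ π))
                         (λ o → avoids (occurrence⇒contains π o))

  catalan⇒avoids : CatalanPair (S-of π) (R-of π) → Avoids π p312
  catalan⇒avoids catalan c =
    no312-if-SR⇒R (app π) (CatalanPair.SR⇒R catalan) (contains⇒occurrence π c)
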